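{- Let $d\ge 1$, $t\ge 1$, $n=2t$ and $u\in\mathcal A_d^n$. Suppose $u$ has period length $t$, and that for some positive integer $\ell<t$ and some $m\in\mathcal A_d$ the string $u'=u^{(t,m)}(t+1-\ell:n-1)$ is $\ell$-periodic. Then $\ell$ divides $t$, and the string $u'\oplus(u_n+m)$ has period length $\ell$ (where $u_n+m$ is taken modulo $d$).
   Context: $\mathcal A_d=\{0,1,\dots,d-1\}$; $\mathcal A_d^n$ is the set of strings $u=u_1\cdots u_n$ over $\mathcal A_d$; $v(a:b)=v_a\cdots v_b$; $\oplus$ is concatenation (a letter is a string of length 1). For a position $t$ and $m\in\mathcal A_d$, $u^{(t,m)}$ is obtained from $u$ by replacing $u_t$ by $(u_t+m)\bmod d$ and keeping all other letters. A string $v$ of length $L$ has period length $\ell$ (a positive integer) if $L\ge 2\ell$ and $v_i=v_{i+\ell}$ for all $1\le i\le L-\ell$; $v$ is $\ell$-periodic if it has period length $\ell$ and no period length $k<\ell$. -}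

module Defs where

open import Data.Nat using (ℕ; zero; suc; _+_; _*_; _∸_; _≤_; _<_; NonZero)
open import Data.Nat.DivMod using (_%_; m%n<n)
open import Data.Fin using (Fin; toℕ; fromℕ<)
open import Data.List using (List; []; _∷_; length; take; drop; _++_; [_])
open import Data.Maybe using (Maybe; just; nothing)
open import Data.Product using (_×_)
open import Relation.Binary.PropositionalEquality using (_≡_)

Str : ℕ → Set
Str d = List (Fin d)

-- 1-based letter access: at v i = just v_i when 1 ≤ i ≤ |v|, nothing otherwise.
at : {A : Set} → List A → ℕ → Maybe A
at []       _             = nothing
at (x ∷ xs) zero          = nothing
at (x ∷ xs) (suc zero)    = just x
at (x ∷ xs) (suc (suc i)) = at xs (suc i)

_+ₘ_ : {d : ℕ} .{{_ : NonZero d}} → Fin d → Fin d → Fin d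
_+ₘ_ {d} a m = fromℕ< (m%n<n (toℕ a + toℕ m) d)

-- v(a:b) = v_a ⋯ v_b  (1-based, inclusive); empty when b < a
sub : {A : Set} → List A → ℕ → ℕ → List A
sub v a b = take (suc b ∸ a) (drop (a ∸ 1) v)

modify : {d : ℕ} .{{_ : NonZero d}} → Str d → ℕ → Fin d → Str d
modify []       _             m = []
modify (x ∷ xs) zero          m = x ∷ xs
modify (x ∷ xs) (suc zero)    m = (x +ₘ m) ∷ xs
modify (x ∷ xs) (suc (suc t)) m = x ∷ modify xs (suc t) m

HasPeriodLength : {A : Set} → ℕ → List A → Set
HasPeriodLength {A} ℓ v =
  (1 ≤ ℓ) × (2 * ℓ ≤ length v) ×
  (∀ i → 1 ≤ i → i + ℓ ≤ length v → at v i ≡ at v (i + ℓ))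

IsPeriodic : {A : Set} → ℕ → List A → Set
IsPeriodic {A} ℓ v = HasPeriodLength ℓ v × (∀ k → k < ℓ → HasPeriodLength k v → Data.Empty.⊥)
  where import Data.Empty

-- Plan.  (1) Periods are studied for an arbitrary function f : ℕ → A on an
-- initial segment [0, N); the main general fact is the Fine–Wilf theorem: if
-- p and q are periods and p + q ≤ N + gcd(p,q), then gcd(p,q) is a period.
-- It is proved by Euclid's algorithm: periods p and p + r on [0, p + M) give
-- the period r on [0, M), and a period g ∣ p on [0, M) extends back to [0, p + M).
-- (2) Letters of strings are read 0-based through `letter`, for which
-- take/drop/++/modify behave as expected, and HasPeriodLength is a period of
-- `letter` in the sense of (1).  (3) In the window, letters t apart never meet
-- the modified position, so w also has "period" t (though |w| < 2t); Fine–Wilf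
-- and the minimality of ℓ force ℓ ∣ t.  Hence w_t = w_ℓ = u_t + m = u_{2t} + m,
-- which is exactly the letter needed to extend the period ℓ by one position.

module Submission where

open import Defs
open import Data.Nat
open import Data.Nat.Properties
open import Data.Nat.Divisibility
open import Data.Nat.GCD
open import Data.Nat.Tactic.RingSolver using (solve-∀)
open import Data.Fin using (Fin)
open import Data.List using (List; []; _∷_; length; take; drop; _++_; [_])
open import Data.List.Properties using (length-take; length-drop; length-++)
open import Data.Maybe using (Maybe; just)
open import Data.Product using (_×_; _,_; ∃-syntax)
open import Data.Empty using (⊥-elim)
open import Data.Sum using (inj₁)
open import Relation.Nullary using (yes; no)
open import Relation.Binary.Definitions using (tri<; tri≈; tri>)
open import Relation.Binary.PropositionalEquality hiding ([_])
open ≡-Reasoning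

-- The gcd specification is invariant under one subtraction step of Euclid's
-- algorithm (the converse of GCD.step from the library).
gcd-unstep : ∀ {p r g} → GCD p (p + r) g → GCD p r g
gcd-unstep G = GCD.is (GCD.gcd∣m G , ∣m+n∣m⇒∣n (GCD.gcd∣n G) (GCD.gcd∣m G))
  (λ { (c∣p , c∣r) → GCD.greatest G (c∣p , ∣m∣n⇒∣m+n c∣p c∣r) })

-- Room for one Euclid step in the Fine–Wilf theorem: if p + (p + r) ≤ N + g
-- with g ≤ r, the segment splits as N = p + M with p + r ≤ M + g and p ≤ M.
euclid-room : ∀ {N p r g} → g ≤ r → p + (p + r) ≤ N + g →
  ∃[ M ] (N ≡ p + M × p + r ≤ M + g × p ≤ M)
euclid-room {N} {p} {r} {g} g≤r len = N ∸ p , sym (m+[n∸m]≡n p≤N) , len′ , m+n≤o⇒m≤o∸n p p+p≤N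
  where
  p+p≤N : p + p ≤ N
  p+p≤N = +-cancelʳ-≤ r (p + p) N
    (subst (_≤ N + r) (sym (+-assoc p p r)) (≤-trans len (+-monoʳ-≤ N g≤r)))
  p≤N : p ≤ N
  p≤N = ≤-trans (m≤m+n p p) p+p≤N
  len′ : p + r ≤ N ∸ p + g
  len′ = +-cancelˡ-≤ p (p + r) (N ∸ p + g)
    (subst (p + (p + r) ≤_) (trans (cong (_+ g) (sym (m+[n∸m]≡n p≤N))) (+-assoc p (N ∸ p) g)) len)

drop-positive : ∀ {x y n} → 0 < x → x + y ≤ suc n → y ≤ n
drop-positive {suc x} _ (s≤s x+y≤n) = m+n≤o⇒n≤o x x+y≤n

module Periods {A : Set} (f : ℕ → A) where

  Period : ℕ → ℕ → Set
  Period N p = ∀ i → i + p < N → f i ≡ f (i + p)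

  period-multiple : ∀ {N p} → Period N p → ∀ k → Period N (k * p)
  period-multiple Pp zero    i _  = cong f (sym (+-identityʳ i))
  period-multiple {N} {p} Pp (suc k) i lt = begin
    f i                ≡⟨ Pp i (≤-<-trans (+-monoʳ-≤ i (m≤m+n p (k * p))) lt) ⟩
    f (i + p)          ≡⟨ period-multiple Pp k (i + p) (subst (_< N) (sym (+-assoc i p (k * p))) lt) ⟩
    f (i + p + k * p)  ≡⟨ cong f (+-assoc i p (k * p)) ⟩
    f (i + (p + k * p)) ∎

  period-difference : ∀ {M p r} → Period (p + M) p → Period (p + M) (p + r) → Period M r
  period-difference {M} {p} {r} Pp Ppr i i+r<M = begin
    f i              ≡⟨ Ppr i (subst (_< p + M) (reorder i) i+r+p<p+M) ⟩
    f (i + (p + r))  ≡⟨ cong f (sym (reorder i)) ⟩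
    f (i + r + p)    ≡⟨ sym (Pp (i + r) i+r+p<p+M) ⟩
    f (i + r)        ∎
    where
    reorder : ∀ i → i + r + p ≡ i + (p + r)
    reorder i = trans (+-assoc i r p) (cong (i +_) (+-comm r p))
    i+r+p<p+M : i + r + p < p + M
    i+r+p<p+M = subst (i + r + p <_) (+-comm M p) (+-monoˡ-< p i+r<M)

  period-extend : ∀ {M p g} → Period (p + M) p → g ∣ p → p ≤ M → Period M g → Period (p + M) g
  period-extend {M} {p} {g} Pp g∣p p≤M Pg i i+g<N with i + g <? M
  ... | yes i+g<M = Pg i i+g<M
  ... | no i+g≮M with p ≤? i
  ...   | yes p≤i = beyond-p p≤i i+g<N
    where
    -- for i = p + j both i and i + g are p-translates of letters inside [0, M)
    beyond-p : ∀ {i} → p ≤ i → i + g < p + M → f i ≡ f (i + g)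
    beyond-p {i} p≤i lt with m≤n⇒∃[o]m+o≡n p≤i
    ... | j , refl = begin
      f (p + j)      ≡⟨ cong f (+-comm p j) ⟩
      f (j + p)      ≡⟨ sym (Pp j (subst (_< p + M) (sym (+-comm j p)) (≤-<-trans (m≤m+n (p + j) g) lt))) ⟩
      f j            ≡⟨ Pg j (+-cancelˡ-< p (j + g) M (subst (_< p + M) (+-assoc p j g) lt)) ⟩
      f (j + g)      ≡⟨ Pp (j + g) (subst (_< p + M) (shuffle p j g) lt) ⟩
      f (j + g + p)  ≡⟨ cong f (sym (shuffle p j g)) ⟩
      f (p + j + g)  ∎
      where
      shuffle : ∀ p j g → p + j + g ≡ j + g + p
      shuffle = solve-∀
  ...   | no p≰i = wrap-around g∣p (≰⇒> p≰i) (≮⇒≥ i+g≮M) i+g<N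
    where
    -- for i < p ≤ M ≤ i + g, write p = (k+1)·g and i + g = p + e: then
    -- f i = f e by the period k·g on [0, M), and f (i + g) = f e by the period p
    wrap-around : ∀ {i} → g ∣ p → i < p → M ≤ i + g → i + g < p + M → f i ≡ f (i + g)
    wrap-around (divides zero p≡0) i<p _ _ = ⊥-elim (n≮0 (subst (_ <_) p≡0 i<p))
    wrap-around {i} (divides (suc k) p≡) i<p M≤i+g lt with m≤n⇒∃[o]m+o≡n (≤-trans p≤M M≤i+g)
    ... | e , p+e≡i+g = begin
      f i              ≡⟨ cong f i≡e+kg ⟩
      f (e + k * g)    ≡⟨ sym (period-multiple Pg k e (subst (_< M) i≡e+kg (<-≤-trans i<p p≤M))) ⟩
      f e              ≡⟨ Pp e (subst (_< p + M) (sym e+p≡i+g) lt) ⟩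
      f (e + p)        ≡⟨ cong f e+p≡i+g ⟩
      f (i + g)        ∎
      where
      e+p≡i+g : e + p ≡ i + g
      e+p≡i+g = trans (+-comm e p) p+e≡i+g
      regroup : ∀ e k g → (g + k * g) + e ≡ (e + k * g) + g
      regroup = solve-∀
      i≡e+kg : i ≡ e + k * g
      i≡e+kg = +-cancelʳ-≡ g i (e + k * g)
        (trans (sym p+e≡i+g) (trans (cong (_+ e) p≡) (regroup e k g)))

  period-restrict : ∀ {M N p} → M ≤ N → Period N p → Period M p
  period-restrict M≤N Pp i lt = Pp i (<-≤-trans lt M≤N)

  fine-wilf-step : ∀ {N p r g} → 0 < r → GCD p (p + r) g → p + (p + r) ≤ N + g →
    (∀ {M} → p + r ≤ M + g → Period M p → Period M r → Period M g) →
    Period N p → Period N (p + r) → Period N g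
  fine-wilf-step {N} {p} {r} {g} 0<r G len IH Pp Ppr
    with euclid-room {N} {p} {r} {g} (∣⇒≤ {{>-nonZero 0<r}} (GCD.gcd∣n (gcd-unstep G))) len
  ... | M , refl , len′ , p≤M =
    period-extend Pp (GCD.gcd∣m G) p≤M
      (IH len′ (period-restrict (m≤n+m M _) Pp) (period-difference Pp Ppr))

  fine-wilf-bounded : ∀ n {N p q g} → p + q ≤ n → GCD p q g → p + q ≤ N + g →
    Period N p → Period N q → Period N g
  fine-wilf-bounded _ {N} {zero} _ G _ _ Pq = subst (Period N) (GCD.unique GCD.base G) Pq
  fine-wilf-bounded _ {N} {suc _} {zero} _ G _ Pp _ =
    subst (Period N) (GCD.unique (GCD.sym GCD.base) G) Pp
  fine-wilf-bounded (suc n) {N} {suc p} {suc q} {g} bound G len Pp Pq with <-cmp (suc p) (suc q)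
  ... | tri≈ _ refl _ = subst (Period N) (GCD.unique GCD.refl G) Pp
  ... | tri< p<q _ _ with m≤n⇒∃[o]m+o≡n (<⇒≤ p<q)
  ...   | zero , refl = ⊥-elim (<-irrefl (sym (+-identityʳ (suc p))) p<q)
  ...   | suc r , refl = fine-wilf-step z<s G len
    (fine-wilf-bounded n (drop-positive z<s bound) (gcd-unstep G)) Pp Pq
  fine-wilf-bounded (suc n) {N} {suc p} {suc q} {g} bound G len Pp Pq | tri> _ _ q<p
    with m≤n⇒∃[o]m+o≡n (<⇒≤ q<p)
  ... | zero , refl = ⊥-elim (<-irrefl (sym (+-identityʳ (suc q))) q<p)
  ... | suc r , refl = fine-wilf-step z<s (GCD.sym G) (subst (_≤ N + g) (+-comm (suc q + suc r) (suc q)) len)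
    (fine-wilf-bounded n (drop-positive z<s (subst (_≤ suc n) (+-comm (suc q + suc r) (suc q)) bound))
      (gcd-unstep (GCD.sym G)))
    Pq Pp

  fine-wilf : ∀ {N p q g} → GCD p q g → p + q ≤ N + g → Period N p → Period N q → Period N g
  fine-wilf {p = p} {q} = fine-wilf-bounded (p + q) ≤-refl

open Periods using (Period; period-multiple; fine-wilf)


module _ {A : Set} where

  letter : List A → ℕ → Maybe A
  letter w j = at w (suc j)

  letter-++ˡ : ∀ (xs ys : List A) {j} → j < length xs → letter (xs ++ ys) j ≡ letter xs j
  letter-++ˡ (x ∷ xs) ys {zero}  _         = refl
  letter-++ˡ (x ∷ xs) ys {suc j} (s≤s j<n) = letter-++ˡ xs ys j<n

  letter-last : ∀ (xs : List A) y → letter (xs ++ [ y ]) (length xs) ≡ just y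
  letter-last []       y = refl
  letter-last (x ∷ xs) y = letter-last xs y

  letter-take : ∀ k (xs : List A) {j} → j < k → letter (take k xs) j ≡ letter xs j
  letter-take (suc k) []       _         = refl
  letter-take (suc k) (x ∷ xs) {zero}  _ = refl
  letter-take (suc k) (x ∷ xs) {suc j} (s≤s j<k) = letter-take k xs j<k

  letter-drop : ∀ s (xs : List A) j → letter (drop s xs) j ≡ letter xs (s + j)
  letter-drop zero    xs       j = refl
  letter-drop (suc s) []       j = refl
  letter-drop (suc s) (x ∷ xs) j = letter-drop s xs j

  letter-window : ∀ {s K} (xs : List A) {j} → j < K → letter (take K (drop s xs)) j ≡ letter xs (s + j)
  letter-window {s} {K} xs {j} j<K = trans (letter-take K (drop s xs) j<K) (letter-drop s xs j)

  at-window : ∀ {s K} (xs : List A) {j} → 1 ≤ j → j ≤ K → at (take K (drop s xs)) j ≡ at xs (s + j)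
  at-window {s} xs {suc j} _ j<K = trans (letter-window xs j<K) (cong (at xs) (sym (+-suc s j)))

  length-window : ∀ {s K} (xs : List A) → s + K ≤ length xs → length (take K (drop s xs)) ≡ K
  length-window {s} {K} xs s+K≤n = begin
    length (take K (drop s xs))  ≡⟨ length-take K (drop s xs) ⟩
    K ⊓ length (drop s xs)       ≡⟨ cong (K ⊓_) (length-drop s xs) ⟩
    K ⊓ (length xs ∸ s)          ≡⟨ m≤n⇒m⊓n≡m (m+n≤o⇒m≤o∸n K (subst (_≤ length xs) (+-comm s K) s+K≤n)) ⟩
    K                            ∎

  period-of : ∀ {p} (w : List A) → HasPeriodLength p w → Period (letter w) (length w) p
  period-of w (_ , _ , P) j j+p<n = P (suc j) (s≤s z≤n) j+p<n

  hasPeriodLength : ∀ {p} (w : List A) → 1 ≤ p → 2 * p ≤ length w →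
    Period (letter w) (length w) p → HasPeriodLength p w
  hasPeriodLength w 1≤p 2p≤n P = 1≤p , 2p≤n , λ { (suc j) _ j+p<n → P j j+p<n }

  -- Fine–Wilf for strings: if w is ℓ-periodic and q is a further period of its
  -- letters with ℓ + q ≤ |w| + 1, then minimality of ℓ forces ℓ ∣ q.
  periodic-divides : ∀ {ℓ q} (w : List A) → IsPeriodic ℓ w → Period (letter w) (length w) q →
    ℓ + q ≤ suc (length w) → ℓ ∣ q
  periodic-divides {ℓ} {q} w (ℓ-period@(1≤ℓ , 2ℓ≤n , _) , minimal) q-period bound with gcd ℓ q ≟ ℓ
  ... | yes g≡ℓ = subst (_∣ q) g≡ℓ (gcd[m,n]∣n ℓ q)
  ... | no g≢ℓ = ⊥-elim (minimal (gcd ℓ q) g<ℓ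
      (hasPeriodLength w 1≤g (≤-trans (*-monoʳ-≤ 2 (<⇒≤ g<ℓ)) 2ℓ≤n) g-period))
    where
    1≤g : 1 ≤ gcd ℓ q
    1≤g = n≢0⇒n>0 (gcd[m,n]≢0 ℓ q (inj₁ (>⇒≢ 1≤ℓ)))
    g<ℓ : gcd ℓ q < ℓ
    g<ℓ = ≤∧≢⇒< (∣⇒≤ {{>-nonZero 1≤ℓ}} (gcd[m,n]∣m ℓ q)) g≢ℓ
    g-period : Period (letter w) (length w) (gcd ℓ q)
    g-period = fine-wilf (letter w) (gcd-GCD ℓ q)
      (≤-trans bound (subst (_≤ length w + gcd ℓ q) (+-comm (length w) 1) (+-monoʳ-≤ (length w) 1≤g)))
      (period-of w ℓ-period) q-period

  at-multiple : ∀ {ℓ t} (w : List A) → HasPeriodLength ℓ w → 1 ≤ t → ℓ ∣ t → t ≤ length w →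
    at w t ≡ at w ℓ
  at-multiple {suc ℓ} w ℓ-period _ (divides (suc k) refl) t≤n =
    sym (period-multiple (letter w) (period-of w ℓ-period) k ℓ t≤n)

  append-period : ∀ {p i} (w : List A) {y} → HasPeriodLength p w → i + p ≡ suc (length w) →
    at w i ≡ just y → HasPeriodLength p (w ++ [ y ])
  append-period {p} {i} w {y} p-period@(1≤p , 2p≤n , _) i+p≡ w-i =
    hasPeriodLength (w ++ [ y ]) 1≤p (≤-trans 2p≤n (≤-trans (n≤1+n _) (≤-reflexive (sym |w++y|))))
      (λ j lt → extended j (s≤s⁻¹ (subst (suc (j + p) ≤_) |w++y| lt)))
    where
    |w++y| : length (w ++ [ y ]) ≡ suc (length w)
    |w++y| = trans (length-++ w) (+-comm (length w) 1)
    extended : ∀ j → j + p ≤ length w → letter (w ++ [ y ]) j ≡ letter (w ++ [ y ]) (j + p)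
    extended j j+p≤n with j + p <? length w
    ... | yes j+p<n = begin
      letter (w ++ [ y ]) j        ≡⟨ letter-++ˡ w [ y ] (≤-<-trans (m≤m+n j p) j+p<n) ⟩
      letter w j                   ≡⟨ period-of w p-period j j+p<n ⟩
      letter w (j + p)             ≡⟨ sym (letter-++ˡ w [ y ] j+p<n) ⟩
      letter (w ++ [ y ]) (j + p)  ∎
    ... | no j+p≮n = begin
      letter (w ++ [ y ]) j        ≡⟨ letter-++ˡ w [ y ] (<-≤-trans (m<m+n j 1≤p) j+p≤n) ⟩
      at w (suc j)                 ≡⟨ cong (at w) suc-j≡i ⟩
      at w i                       ≡⟨ w-i ⟩
      just y                       ≡⟨ sym (letter-last w y) ⟩
      letter (w ++ [ y ]) (length w) ≡⟨ cong (letter (w ++ [ y ])) (sym j+p≡n) ⟩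
      letter (w ++ [ y ]) (j + p)  ∎
      where
      j+p≡n : j + p ≡ length w
      j+p≡n = ≤-antisym j+p≤n (≮⇒≥ j+p≮n)
      suc-j≡i : suc j ≡ i
      suc-j≡i = +-cancelʳ-≡ p (suc j) i (trans (cong suc j+p≡n) (sym i+p≡))

module _ {d : ℕ} .{{_ : NonZero d}} where

  length-modify : ∀ (xs : Str d) t m → length (modify xs t m) ≡ length xs
  length-modify []       t             m = refl
  length-modify (x ∷ xs) zero          m = refl
  length-modify (x ∷ xs) (suc zero)    m = refl
  length-modify (x ∷ xs) (suc (suc t)) m = cong suc (length-modify xs (suc t) m)

  letter-modify-≢ : ∀ (xs : Str d) {t} m {j} → suc j ≢ t → letter (modify xs t m) j ≡ letter xs j
  letter-modify-≢ []                     m         _  = refl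
  letter-modify-≢ (x ∷ xs) {zero}        m         _  = refl
  letter-modify-≢ (x ∷ xs) {suc zero}    m {zero}  ne = ⊥-elim (ne refl)
  letter-modify-≢ (x ∷ xs) {suc zero}    m {suc j} _  = refl
  letter-modify-≢ (x ∷ xs) {suc (suc t)} m {zero}  _  = refl
  letter-modify-≢ (x ∷ xs) {suc (suc t)} m {suc j} ne = letter-modify-≢ xs m (λ e → ne (cong suc e))

  at-modify : ∀ (xs : Str d) {t} m {x} → at xs t ≡ just x → at (modify xs t m) t ≡ just (x +ₘ m)
  at-modify (y ∷ xs) {suc zero}    m refl = refl
  at-modify (y ∷ xs) {suc (suc t)} m eq   = at-modify xs m eq

  -- Letters t apart inside a window take K (drop s (u^{(t,m)})) with s + K < 2t
  -- never meet the modified position t, so the period t of u survives in the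
  -- window, even though the window may be shorter than 2t.
  window-period : ∀ (u : Str d) {t s K} m → Period (letter u) (length u) t →
    s + K ≤ length u → s + K < t + t → Period (letter (take K (drop s (modify u t m)))) K t
  window-period u {t} {s} {K} m u-period s+K≤n s+K<2t j j+t<K = begin
    letter w j                     ≡⟨ letter-window {s = s} {K = K} u′ (≤-<-trans (m≤m+n j t) j+t<K) ⟩
    letter u′ (s + j)              ≡⟨ letter-modify-≢ u m (<⇒≢ before-t) ⟩
    letter u (s + j)               ≡⟨ u-period (s + j) inside ⟩
    letter u (s + j + t)           ≡⟨ sym (letter-modify-≢ u m (>⇒≢ (s≤s (m≤n+m t (s + j))))) ⟩
    letter u′ (s + j + t)          ≡⟨ cong (letter u′) (+-assoc s j t) ⟩
    letter u′ (s + (j + t))        ≡⟨ sym (letter-window {s = s} {K = K} u′ j+t<K) ⟩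
    letter w (j + t)               ∎
    where
    u′ = modify u t m
    w = take K (drop s u′)
    s+j+t<s+K : s + j + t < s + K
    s+j+t<s+K = subst (_< s + K) (sym (+-assoc s j t)) (+-monoʳ-< s j+t<K)
    inside : s + j + t < length u
    inside = <-≤-trans s+j+t<s+K s+K≤n
    before-t : suc (s + j) < t
    before-t = +-cancelʳ-< t (suc (s + j)) t (≤-trans (s≤s s+j+t<s+K) s+K<2t)

-- The shape of the window u′(t+1-ℓ : 2t-1) = take K (drop s u′): it skips
-- s = t - ℓ letters and keeps K = t + ℓ - 1, ending just before position 2t.
record WindowShape (t ℓ s K : ℕ) : Set where
  field
    ℓ-th-is-t  : s + ℓ ≡ t        -- the ℓ-th window letter is u′_t
    length-eq  : t + ℓ ≡ suc K
    ends-early : s + K < t + t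

window-shape : ∀ {t ℓ} → ℓ < t → WindowShape t ℓ (suc t ∸ ℓ ∸ 1) (suc (2 * t ∸ 1) ∸ (suc t ∸ ℓ))
window-shape {t} {ℓ} ℓ<t with m≤n⇒∃[o]m+o≡n ℓ<t
... | e , refl = record
  { ℓ-th-is-t  = trans (cong (λ a → a ∸ 1 + ℓ) start) (cong suc (+-comm e ℓ))
  ; length-eq  = cong suc (sym length′)
  ; ends-early = ≤-reflexive (trans (cong₂ (λ a k → suc (a ∸ 1 + k)) start length′) (total ℓ e))
  }
  where
  start : suc (suc (ℓ + e)) ∸ ℓ ≡ suc (suc e)
  start = trans (+-∸-assoc 2 (m≤m+n ℓ e)) (cong (2 +_) (m+n∸m≡n ℓ e))
  last : ∀ ℓ e → ℓ + e + suc (ℓ + e + 0) ≡ suc e + (ℓ + e + ℓ)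
  last = solve-∀
  length′ : suc (2 * suc (ℓ + e) ∸ 1) ∸ (suc (suc (ℓ + e)) ∸ ℓ) ≡ ℓ + e + ℓ
  length′ = begin
    suc (2 * suc (ℓ + e) ∸ 1) ∸ (suc (suc (ℓ + e)) ∸ ℓ)  ≡⟨ cong (suc (2 * suc (ℓ + e) ∸ 1) ∸_) start ⟩
    ℓ + e + suc (ℓ + e + 0) ∸ suc e                     ≡⟨ cong (_∸ suc e) (last ℓ e) ⟩
    suc e + (ℓ + e + ℓ) ∸ suc e                         ≡⟨ m+n∸m≡n (suc e) (ℓ + e + ℓ) ⟩
    ℓ + e + ℓ                                          ∎
  total : ∀ ℓ e → suc (suc e + (ℓ + e + ℓ)) ≡ suc (ℓ + e) + suc (ℓ + e)
  total = solve-∀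

t+t≡2*t : ∀ t → t + t ≡ 2 * t
t+t≡2*t t = cong (t +_) (sym (+-identityʳ t))

at-half : ∀ {A : Set} {t} (u : List A) → HasPeriodLength t u → 1 ≤ t → length u ≡ 2 * t →
  at u t ≡ at u (2 * t)
at-half {t = t} u (_ , _ , P) 1≤t |u|≡2t =
  trans (P t 1≤t (≤-reflexive (trans (t+t≡2*t t) (sym |u|≡2t)))) (cong (at u) (t+t≡2*t t))

lemma2p17 : (d t : ℕ) .{{_ : NonZero d}} → 1 ≤ t → (u : Str d) → length u ≡ 2 * t →
    HasPeriodLength t u →
    (ℓ : ℕ) → 1 ≤ ℓ → ℓ < t → (m : Fin d) → (un : Fin d) → at u (2 * t) ≡ just un →
    IsPeriodic ℓ (sub (modify u t m) (suc t ∸ ℓ) (2 * t ∸ 1)) →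
    (ℓ ∣ t) × HasPeriodLength ℓ (sub (modify u t m) (suc t ∸ ℓ) (2 * t ∸ 1) ++ [ un +ₘ m ])
lemma2p17 d t 1≤t u |u|≡2t u-period ℓ 1≤ℓ ℓ<t m un u-2t w-periodic@(w-period , _) =
  ℓ∣t , append-period w w-period t+ℓ≡|w|+1 w-t
  where
  u′ = modify u t m
  s = suc t ∸ ℓ ∸ 1
  K = suc (2 * t ∸ 1) ∸ (suc t ∸ ℓ)
  w = sub u′ (suc t ∸ ℓ) (2 * t ∸ 1)
  open WindowShape (window-shape ℓ<t)
  s+K≤|u| : s + K ≤ length u
  s+K≤|u| = ≤-trans (<⇒≤ ends-early) (≤-reflexive (trans (t+t≡2*t t) (sym |u|≡2t)))
  |w|≡K : length w ≡ K
  |w|≡K = length-window u′ (subst (s + K ≤_) (sym (length-modify u t m)) s+K≤|u|)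
  t+ℓ≡|w|+1 : t + ℓ ≡ suc (length w)
  t+ℓ≡|w|+1 = trans length-eq (cong suc (sym |w|≡K))
  t≤K : t ≤ K
  t≤K = +-cancelʳ-≤ ℓ t K (≤-trans (≤-reflexive (trans length-eq (+-comm 1 K))) (+-monoʳ-≤ K 1≤ℓ))
  w-period-t : Period (letter w) (length w) t
  w-period-t = subst (λ N → Period (letter w) N t) (sym |w|≡K)
    (window-period u m (period-of u u-period) s+K≤|u| ends-early)
  ℓ∣t : ℓ ∣ t
  ℓ∣t = periodic-divides w w-periodic w-period-t
    (≤-reflexive (trans (+-comm ℓ t) t+ℓ≡|w|+1))
  w-t : at w t ≡ just (un +ₘ m)
  w-t = begin
    at w t          ≡⟨ at-multiple w w-period 1≤t ℓ∣t (subst (t ≤_) (sym |w|≡K) t≤K) ⟩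
    at w ℓ          ≡⟨ at-window {s = s} {K = K} u′ 1≤ℓ (≤-trans (<⇒≤ ℓ<t) t≤K) ⟩
    at u′ (s + ℓ)   ≡⟨ cong (at u′) ℓ-th-is-t ⟩
    at u′ t         ≡⟨ at-modify u m (trans (at-half u u-period 1≤t |u|≡2t) u-2t) ⟩
    just (un +ₘ m)  ∎
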